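{- For every integer $r \geq 4$ there exists $n_0 = n_0(r)$ such that for every $n \geq n_0$ there is a graph $G$ on $n$ vertices with $\delta(G) = \lfloor n/2 \rfloor + (r-4)$ and $m(G, r) > r$.
   Context: Graphs are finite and simple; $\delta(G)$ is the minimum degree and $N(v)$ the neighbourhood of $v$. For an integer $r \geq 2$, the $r$-neighbour bootstrap process on $G$ started from $A \subseteq V(G)$ is defined by $A_0 = A$ and $A_t = A_{t-1} \cup \{v \in V(G) : |N(v) \cap A_{t-1}| \geq r\}$ for $t \geq 1$. The closure is $\langle A \rangle_r = \bigcup_{t \geq 0} A_t$. The set $A$ percolates if $\langle A \rangle_r = V(G)$. Define $m(G,r) = \min\{|A| : A \subseteq V(G),\ \langle A \rangle_r = V(G)\}$. -}

module Defs where

open import Data.Nat using (ℕ; zero; suc; _+_; _≤_; _<_; _/_)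
open import Data.Bool using (Bool; true; false; if_then_else_; _∨_)
open import Data.Fin using (Fin)
open import Data.List using (List; map; allFin)
open import Data.Nat.ListAction using (sum)
open import Data.Product using (Σ; _×_; ∃)
open import Relation.Binary.PropositionalEquality using (_≡_)

record Graph (n : ℕ) : Set where
  field
    adj   : Fin n → Fin n → Bool
    sym   : ∀ u v → adj u v ≡ adj v u
    irrefl : ∀ v → adj v v ≡ false
open Graph public

VSet : ℕ → Set
VSet n = Fin n → Bool

size : {n : ℕ} → VSet n → ℕ
size {n} A = sum (map (λ v → if A v then 1 else 0) (allFin n))

nbhd : {n : ℕ} → Graph n → Fin n → VSet n
nbhd G v = adj G v

_∩_ : {n : ℕ} → VSet n → VSet n → VSet n
(A ∩ B) v = if A v then B v else false

deg : {n : ℕ} → Graph n → Fin n → ℕ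
deg G v = size (nbhd G v)

MinDegreeIs : {n : ℕ} → Graph n → ℕ → Set
MinDegreeIs {n} G d = (∀ v → d ≤ deg G v) × ∃ λ v → deg G v ≡ d

_≤ᵇ_ : ℕ → ℕ → Bool
zero ≤ᵇ k = true
suc r ≤ᵇ zero = false
suc r ≤ᵇ suc k = r ≤ᵇ k

bootstrap : {n : ℕ} → Graph n → ℕ → VSet n → ℕ → VSet n
bootstrap G r A zero v = A v
bootstrap G r A (suc t) v =
  bootstrap G r A t v ∨ (r ≤ᵇ size (nbhd G v ∩ bootstrap G r A t))

InClosure : {n : ℕ} → Graph n → ℕ → VSet n → Fin n → Set
InClosure G r A v = ∃ λ t → bootstrap G r A t v ≡ true

Percolates : {n : ℕ} → Graph n → ℕ → VSet n → Set
Percolates G r A = ∀ v → InClosure G r A v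

-- m(G,r) > k : every percolating set has more than k elements
-- (the minimum exists since V(G) itself percolates)
mGreaterThan : {n : ℕ} → Graph n → ℕ → ℕ → Set
mGreaterThan {n} G r k = ∀ (A : VSet n) → Percolates G r A → k < size A

-- Take cliques X and Y with |X| = ⌊n/2⌋ and |Y| = ⌈n/2⌉, and join x ∈ X to y ∈ Y when
-- x + y mod |Y| is one of 2⁰, 2¹, …, 2^(d-1), where d = r - 3.  Every x ∈ X then has exactly d
-- neighbours in Y, every y ∈ Y at least d - (|Y| - |X|) in X, so δ = ⌊n/2⌋ + d - 1; and since
-- sums of two powers of two determine the powers, the edges between X and Y contain no C₄.
--
-- A set A of at most r vertices cannot percolate.  If |A| < r, then A is already closed.  If A meets
-- one clique in at most two vertices, then A together with the other clique is closed, since a vertex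
-- outside it has at most 2 + d < r neighbours in it.  Otherwise A meets the cliques in a, b ≥ 3
-- vertices with a + b = r, and by induction on time each clique gains at most one vertex outside A.
-- Indeed, a second newcomer u in X beside the first one x would need b - 1 infected neighbours in
-- Y while x needed b, and they share at most one, so b = 3 and d = a; one then finds a vertex of Y
-- adjacent to all of A ∩ X and to x or u, i.e. to d + 1 vertices of X.  So at most a + 1 < r
-- vertices of X are ever infected.

module Submission where

open import Data.Nat.Properties
open import Algebra.Properties.CommutativeMonoid.Sum +-0-commutativeMonoid
  using (sum; ∑-distrib-+; sum-cong-≗)
open import Algebra.Properties.CommutativeSemigroup +-commutativeSemigroup
  using (xy∙z≈xz∙y; xy∙z≈y∙xz; xy∙z≈zx∙y; x∙yz≈xz∙y)
open import Data.Bool using (Bool; true; false; not; _∧_; _∨_; if_then_else_)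
open import Data.Bool.Properties using (not-involutive; ∨-zeroʳ; ∧-zeroʳ; ∧-identityʳ; ¬-not; not-¬)
  renaming (_≟_ to _≟ᵇ_)
open import Data.Empty using (⊥; ⊥-elim)
open import Data.Fin using (Fin; zero; suc; toℕ; fromℕ<; _↑ˡ_; _↑ʳ_; splitAt; join)
  renaming (_≟_ to _≟ᶠ_)
open import Data.Fin.Properties
  using (any?; splitAt-↑ˡ; splitAt-↑ʳ; join-splitAt; toℕ<n; toℕ-fromℕ<; toℕ-injective; toℕ-↑ˡ)
import Data.Fin.Properties as Fin
open import Data.List using (tabulate)
open import Data.List.Properties using (map-tabulate)
open import Data.Nat
  using (ℕ; zero; suc; _+_; _*_; _∸_; _^_; _%_; _/_; _≤_; _<_; z≤n; s≤s; s≤s⁻¹; _<?_; _≤?_;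
         NonZero; >-nonZero)
open import Data.Nat.DivMod
  using (m%n<n; m%n%n≡m%n; %-distribˡ-+; [m+n]%n≡m%n; m<n⇒m%n≡m; m≡m%n+[m/n]*n; m*n/n≡m; /-monoˡ-≤)
open import Data.Nat.ListAction using () renaming (sum to sumˡ)
open import Data.Nat.Logarithm using (⌊log₂_⌋; ⌊log₂[2^n]⌋≡n)
open import Data.Nat.Tactic.RingSolver using (solve-∀)
open import Data.Product using (Σ; _×_; ∃; _,_; proj₁; proj₂)
open import Data.Sum using (_⊎_; inj₁; inj₂; [_,_]′)
open import Data.Sum.Properties using (inj₂-injective)
open import Function using (_∘_; case_of_)
open import Function.Bundles using (mk⇔)
open import Function.Definitions using (Injective)
open import Relation.Binary.PropositionalEquality
open import Relation.Nullary using (¬_; Dec; yes; no; does)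
open import Relation.Nullary.Decidable using (dec-true; does-⇔)

open import Defs hiding (sym; _∩_)
import Defs

private variable
  n : ℕ

-- Sets of vertices

infix 4 _∈_ _∉_ _⊆_
infixr 7 _∩_
infixr 6 _∪_
infixl 6 _∖_

record _∈_ (v : Fin n) (P : VSet n) : Set where
  constructor ∈-intro
  field ∈-elim : P v ≡ true

record _∉_ (v : Fin n) (P : VSet n) : Set where
  constructor ∉-intro
  field ∉-elim : P v ≡ false

open _∈_
open _∉_

_⊆_ : VSet n → VSet n → Set
P ⊆ Q = ∀ {v} → v ∈ P → v ∈ Q

∈-or-∉ : (P : VSet n) (v : Fin n) → v ∈ P ⊎ v ∉ P
∈-or-∉ P v with P v in eq
... | true  = inj₁ (∈-intro eq)
... | false = inj₂ (∉-intro eq)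

∈∉-contra : ∀ {P : VSet n} {v} → v ∈ P → v ∉ P → ⊥
∈∉-contra (∈-intro v∈P) (∉-intro v∉P) with trans (sym v∈P) v∉P
... | ()

-- Opaque, so that unification can read the two sets off a membership goal.
opaque
  _∩_ _∪_ _∖_ : VSet n → VSet n → VSet n
  (P ∩ Q) v = P v ∧ Q v
  (P ∪ Q) v = P v ∨ Q v
  (P ∖ Q) v = P v ∧ not (Q v)

opaque
  unfolding _∩_

  ∩-apply : (P Q : VSet n) (v : Fin n) → (P ∩ Q) v ≡ P v ∧ Q v
  ∩-apply P Q v = refl

  ∪-apply : (P Q : VSet n) (v : Fin n) → (P ∪ Q) v ≡ P v ∨ Q v
  ∪-apply P Q v = refl

  ∖-apply : (P Q : VSet n) (v : Fin n) → (P ∖ Q) v ≡ P v ∧ not (Q v)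
  ∖-apply P Q v = refl

∩⁺ : ∀ {P Q : VSet n} {v} → v ∈ P → v ∈ Q → v ∈ P ∩ Q
∩⁺ {P = P} {Q} {v} (∈-intro v∈P) (∈-intro v∈Q) =
  ∈-intro (trans (∩-apply P Q v) (cong₂ _∧_ v∈P v∈Q))

∩⁻ : ∀ {P Q : VSet n} {v} → v ∈ P ∩ Q → v ∈ P × v ∈ Q
∩⁻ {P = P} {Q} {v} (∈-intro h) with P v in eq | Q v in eq' | trans (sym (∩-apply P Q v)) h
... | true | true | _ = ∈-intro eq , ∈-intro eq'

∩⁻ˡ : ∀ {P Q : VSet n} → P ∩ Q ⊆ P
∩⁻ˡ = proj₁ ∘ ∩⁻

∩⁻ʳ : ∀ {P Q : VSet n} → P ∩ Q ⊆ Q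
∩⁻ʳ = proj₂ ∘ ∩⁻

∉-∩ˡ : ∀ {P Q : VSet n} {v} → v ∉ P → v ∉ P ∩ Q
∉-∩ˡ {P = P} {Q} {v} (∉-intro v∉P) = ∉-intro (trans (∩-apply P Q v) (cong (_∧ Q v) v∉P))

∖⁺ : ∀ {P Q : VSet n} {v} → v ∈ P → v ∉ Q → v ∈ P ∖ Q
∖⁺ {P = P} {Q} {v} (∈-intro v∈P) (∉-intro v∉Q) =
  ∈-intro (trans (∖-apply P Q v) (cong₂ (λ a b → a ∧ not b) v∈P v∉Q))

∖⁻ : ∀ {P Q : VSet n} {v} → v ∈ P ∖ Q → v ∈ P × v ∉ Q
∖⁻ {P = P} {Q} {v} (∈-intro h) with P v in eq | Q v in eq' | trans (sym (∖-apply P Q v)) h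
... | true | false | _ = ∈-intro eq , ∉-intro eq'

∪⁺ˡ : ∀ {P Q : VSet n} → P ⊆ P ∪ Q
∪⁺ˡ {P = P} {Q} {v} (∈-intro v∈P) = ∈-intro (trans (∪-apply P Q v) (cong (_∨ Q v) v∈P))

∪⁺ʳ : ∀ {P Q : VSet n} → Q ⊆ P ∪ Q
∪⁺ʳ {P = P} {Q} {v} (∈-intro v∈Q) =
  ∈-intro (trans (∪-apply P Q v) (trans (cong (P v ∨_) v∈Q) (∨-zeroʳ (P v))))

∪⁻ : ∀ {P Q : VSet n} {v} → v ∈ P ∪ Q → v ∈ P ⊎ v ∈ Q
∪⁻ {P = P} {Q} {v} (∈-intro h) with P v in eq | trans (sym (∪-apply P Q v)) h
... | true  | _   = inj₁ (∈-intro eq)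
... | false | v∈Q = inj₂ (∈-intro v∈Q)

⊆? : (P Q : VSet n) → P ⊆ Q ⊎ ∃ λ v → v ∈ P × v ∉ Q
⊆? P Q with any? (λ v → (P ∖ Q) v ≟ᵇ true)
... | yes (v , v∈P∖Q) = inj₂ (v , ∖⁻ (∈-intro v∈P∖Q))
... | no ∄ = inj₁ P⊆Q
  where
  P⊆Q : P ⊆ Q
  P⊆Q {v} v∈P with ∈-or-∉ Q v
  ... | inj₁ v∈Q = v∈Q
  ... | inj₂ v∉Q = ⊥-elim (∄ (v , ∈-elim (∖⁺ v∈P v∉Q)))

true⇒witness : ∀ {a} {A : Set a} (a? : Dec A) → does a? ≡ true → A
true⇒witness (yes a) _ = a

single : Fin n → VSet n
single v w = does (v ≟ᶠ w)

∈-single : ∀ {v w : Fin n} → w ∈ single v → v ≡ w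
∈-single {v = v} {w} (∈-intro h) = true⇒witness (v ≟ᶠ w) h

single-∋ : (v : Fin n) → v ∈ single v
single-∋ v = ∈-intro (dec-true (v ≟ᶠ v) refl)

single-sym : (v w : Fin n) → single v w ≡ single w v
single-sym v w = does-⇔ (mk⇔ sym sym) (v ≟ᶠ w) (w ≟ᶠ v)

module _ {d : ℕ} (f : Fin d → Fin n) where

  image : VSet n
  image w = does (any? λ i → f i ≟ᶠ w)

  ∈-image⁺ : ∀ i → f i ∈ image
  ∈-image⁺ i = ∈-intro (dec-true (any? λ j → f j ≟ᶠ f i) (i , refl))

  ∈-image⁻ : ∀ {w} → w ∈ image → ∃ λ i → f i ≡ w
  ∈-image⁻ {w} (∈-intro h) = true⇒witness (any? λ i → f i ≟ᶠ w) h

-- Counting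

χ : Bool → ℕ
χ b = if b then 1 else 0

χ≤1 : ∀ b → χ b ≤ 1
χ≤1 false = z≤n
χ≤1 true  = s≤s z≤n

χ-mono : ∀ {b c} → (b ≡ true → c ≡ true) → χ b ≤ χ c
χ-mono {false} _ = z≤n
χ-mono {true}  h rewrite h refl = ≤-refl

∑-mono-≤ : ∀ {m} {f g : Fin m → ℕ} → (∀ i → f i ≤ g i) → sum f ≤ sum g
∑-mono-≤ {zero}  f≤g = z≤n
∑-mono-≤ {suc m} f≤g = +-mono-≤ (f≤g zero) (∑-mono-≤ (f≤g ∘ suc))

∑-mono-< : ∀ {m} {f g : Fin m → ℕ} → (∀ i → f i ≤ g i) → ∀ j → f j < g j → sum f < sum g
∑-mono-< f≤g zero    fj<gj = +-mono-<-≤ fj<gj (∑-mono-≤ (f≤g ∘ suc))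
∑-mono-< f≤g (suc j) fj<gj = +-mono-≤-< (f≤g zero) (∑-mono-< (f≤g ∘ suc) j fj<gj)

term≤∑ : ∀ {m} (f : Fin m → ℕ) i → f i ≤ sum f
term≤∑ f zero    = m≤m+n (f zero) _
term≤∑ f (suc i) = ≤-trans (term≤∑ (f ∘ suc) i) (m≤n+m _ (f zero))

sumˡ-tabulate : ∀ {m} (f : Fin m → ℕ) → sumˡ (tabulate f) ≡ sum f
sumˡ-tabulate {zero}  f = refl
sumˡ-tabulate {suc m} f = cong (f zero +_) (sumˡ-tabulate (f ∘ suc))

size≡∑χ : (P : VSet n) → size P ≡ sum (χ ∘ P)
size≡∑χ P = trans (cong sumˡ (map-tabulate (λ v → v) (χ ∘ P))) (sumˡ-tabulate (χ ∘ P))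

size-suc : (P : VSet (suc n)) → size P ≡ χ (P zero) + size (P ∘ suc)
size-suc P = trans (size≡∑χ P) (cong (χ (P zero) +_) (sym (size≡∑χ (P ∘ suc))))

size-cong : ∀ {P Q : VSet n} → (∀ v → P v ≡ Q v) → size P ≡ size Q
size-cong {P = P} {Q} P≗Q = trans (size≡∑χ P) (trans (sum-cong-≗ (cong χ ∘ P≗Q)) (sym (size≡∑χ Q)))

size-pointwise-≡ : ∀ {P Q R S : VSet n} → (∀ v → χ (P v) + χ (Q v) ≡ χ (R v) + χ (S v)) →
                   size P + size Q ≡ size R + size S
size-pointwise-≡ {P = P} {Q} {R} {S} eq = begin
  size P + size Q                     ≡⟨ cong₂ _+_ (size≡∑χ P) (size≡∑χ Q) ⟩
  sum (χ ∘ P) + sum (χ ∘ Q)           ≡⟨ ∑-distrib-+ (χ ∘ P) (χ ∘ Q) ⟨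
  sum (λ v → χ (P v) + χ (Q v))       ≡⟨ sum-cong-≗ eq ⟩
  sum (λ v → χ (R v) + χ (S v))       ≡⟨ ∑-distrib-+ (χ ∘ R) (χ ∘ S) ⟩
  sum (χ ∘ R) + sum (χ ∘ S)           ≡⟨ cong₂ _+_ (size≡∑χ R) (size≡∑χ S) ⟨
  size R + size S                     ∎
  where open ≡-Reasoning

size-∅ : ∀ {P : VSet n} → (∀ v → v ∉ P) → size P ≡ 0
size-∅ {zero}          ∄ = refl
size-∅ {suc n} {P = P} ∄ =
  trans (size-suc P) (cong₂ _+_ (cong χ (∉-elim (∄ zero))) (size-∅ λ v → ∉-intro (∉-elim (∄ (suc v)))))

size-empty : ∀ n → size (λ (_ : Fin n) → false) ≡ 0
size-empty n = size-∅ {n} {P = λ _ → false} λ _ → ∉-intro refl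

size-full : ∀ n → size (λ (_ : Fin n) → true) ≡ n
size-full zero    = refl
size-full (suc n) = trans (size-suc {n} (λ _ → true)) (cong suc (size-full n))

size≤ : (P : VSet n) → size P ≤ n
size≤ {zero}  P = z≤n
size≤ {suc n} P = subst (_≤ suc n) (sym (size-suc P)) (+-mono-≤ (χ≤1 (P zero)) (size≤ (P ∘ suc)))

⊆⇒χ≤ : ∀ {P Q : VSet n} → P ⊆ Q → ∀ v → χ (P v) ≤ χ (Q v)
⊆⇒χ≤ P⊆Q v = χ-mono (∈-elim ∘ P⊆Q {v} ∘ ∈-intro)

size-mono : ∀ {P Q : VSet n} → P ⊆ Q → size P ≤ size Q
size-mono {P = P} {Q} P⊆Q = subst₂ _≤_ (sym (size≡∑χ P)) (sym (size≡∑χ Q)) (∑-mono-≤ (⊆⇒χ≤ P⊆Q))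

size-⊆⊇ : ∀ {P Q : VSet n} → P ⊆ Q → Q ⊆ P → size P ≡ size Q
size-⊆⊇ P⊆Q Q⊆P = ≤-antisym (size-mono P⊆Q) (size-mono Q⊆P)

size-⊂ : ∀ {P Q : VSet n} {w} → P ⊆ Q → w ∈ Q → w ∉ P → size P < size Q
size-⊂ {P = P} {Q} {w} P⊆Q (∈-intro w∈Q) (∉-intro w∉P) = subst₂ _<_ (sym (size≡∑χ P)) (sym (size≡∑χ Q))
  (∑-mono-< (⊆⇒χ≤ P⊆Q) w (subst₂ (λ b c → χ b < χ c) (sym w∉P) (sym w∈Q) ≤-refl))

size-≤⇒⊇ : ∀ {P Q : VSet n} → P ⊆ Q → size Q ≤ size P → Q ⊆ P
size-≤⇒⊇ {P = P} P⊆Q Q≤P {v} v∈Q with ∈-or-∉ P v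
... | inj₁ v∈P = v∈P
... | inj₂ v∉P = ⊥-elim (<⇒≱ (size-⊂ P⊆Q v∈Q v∉P) Q≤P)

size-<⇒⊈ : ∀ {P Q : VSet n} → size Q < size P → ∃ λ v → v ∈ P × v ∉ Q
size-<⇒⊈ {P = P} {Q} Q<P with ⊆? P Q
... | inj₁ P⊆Q = ⊥-elim (<⇒≱ Q<P (size-mono P⊆Q))
... | inj₂ v∈P∖Q = v∈P∖Q

size-∪-∩ : (P Q : VSet n) → size (P ∪ Q) + size (P ∩ Q) ≡ size P + size Q
size-∪-∩ P Q = size-pointwise-≡ pointwise
  where
  pointwise : ∀ v → χ ((P ∪ Q) v) + χ ((P ∩ Q) v) ≡ χ (P v) + χ (Q v)
  pointwise v rewrite ∪-apply P Q v | ∩-apply P Q v with P v | Q v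
  ... | true  | true  = refl
  ... | true  | false = refl
  ... | false | true  = refl
  ... | false | false = refl

size-⊆-∪ : ∀ {P Q R : VSet n} → P ⊆ Q ∪ R → size P ≤ size Q + size R
size-⊆-∪ {Q = Q} {R} P⊆Q∪R = ≤-trans (size-mono P⊆Q∪R) (≤-trans (m≤m+n _ _) (≤-reflexive (size-∪-∩ Q R)))

size-∩-overlap : ∀ {P Q S : VSet n} → P ⊆ S → Q ⊆ S → size P + size Q ≤ size S + size (P ∩ Q)
size-∩-overlap {P = P} {Q} {S} P⊆S Q⊆S = begin
  size P + size Q               ≡⟨ size-∪-∩ P Q ⟨
  size (P ∪ Q) + size (P ∩ Q)   ≤⟨ +-monoˡ-≤ _ (size-mono P∪Q⊆S) ⟩
  size S + size (P ∩ Q)         ∎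
  where
  open ≤-Reasoning
  P∪Q⊆S : P ∪ Q ⊆ S
  P∪Q⊆S h with ∪⁻ h
  ... | inj₁ v∈P = P⊆S v∈P
  ... | inj₂ v∈Q = Q⊆S v∈Q

size-∩-∖ : (P Q : VSet n) → size (P ∩ Q) + size (P ∖ Q) ≡ size P
size-∩-∖ {n} P Q =
  trans (size-pointwise-≡ pointwise) (trans (cong (size P +_) (size-empty n)) (+-identityʳ (size P)))
  where
  pointwise : ∀ v → χ ((P ∩ Q) v) + χ ((P ∖ Q) v) ≡ χ (P v) + χ false
  pointwise v rewrite ∩-apply P Q v | ∖-apply P Q v with P v | Q v
  ... | true  | true  = refl
  ... | true  | false = refl
  ... | false | true  = refl
  ... | false | false = refl

size≤1 : ∀ {P : VSet n} → (∀ {v w} → v ∈ P → w ∈ P → v ≡ w) → size P ≤ 1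
size≤1 {zero}          _    = z≤n
size≤1 {suc n} {P = P} uniq with ∈-or-∉ P zero
... | inj₁ 0∈P = ≤-reflexive (trans (size-suc P) (cong₂ _+_ (cong χ (∈-elim 0∈P)) (size-∅ rest-empty)))
  where
  rest-empty : ∀ v → v ∉ P ∘ suc
  rest-empty v with ∈-or-∉ P (suc v)
  ... | inj₁ sv∈P = case uniq 0∈P sv∈P of λ ()
  ... | inj₂ sv∉P = ∉-intro (∉-elim sv∉P)
... | inj₂ 0∉P = subst (_≤ 1) (sym (trans (size-suc P) (cong (_+ size (P ∘ suc)) (cong χ (∉-elim 0∉P)))))
  (size≤1 λ v∈P w∈P → Fin.suc-injective (uniq (∈-intro (∈-elim v∈P)) (∈-intro (∈-elim w∈P))))

size-single : (v : Fin n) → size (single v) ≡ 1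
size-single {n} v = ≤-antisym (size≤1 {P = single v} λ a b → trans (sym (∈-single {v = v} a)) (∈-single {v = v} b))
  (subst (_< size (single v)) (size-empty n)
    (size-⊂ {P = λ _ → false} (λ { (∈-intro ()) }) (single-∋ v) (∉-intro refl)))

size-others : (v : Fin n) → size (not ∘ single v) + 1 ≡ n
size-others {n} v = begin
  size (not ∘ single v) + 1                                    ≡⟨ cong (size (not ∘ single v) +_) (size-single v) ⟨
  size (not ∘ single v) + size (single v)                      ≡⟨ size-pointwise-≡ pointwise ⟩
  size (λ (_ : Fin n) → true) + size (λ (_ : Fin n) → false)   ≡⟨ cong₂ _+_ (size-full n) (size-empty n) ⟩
  n + 0                                                        ≡⟨ +-identityʳ n ⟩
  n                                                            ∎
  where
  open ≡-Reasoning
  pointwise : ∀ w → χ (not (single v w)) + χ (single v w) ≡ χ true + χ false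
  pointwise w with single v w
  ... | true  = refl
  ... | false = refl

size-image : ∀ {d} (f : Fin d → Fin n) → Injective _≡_ _≡_ f → size (image f) ≡ d
size-image f inj = ≤-antisym (at-most f) (at-least f inj)
  where
  at-most : ∀ {d} (f : Fin d → Fin n) → size (image f) ≤ d
  at-most {d = zero}  f = ≤-reflexive (size-∅ {P = image f} λ _ → ∉-intro refl)
  at-most {d = suc d} f =
    ≤-trans (size-⊆-∪ cover) (+-mono-≤ (≤-reflexive (size-single (f zero))) (at-most (f ∘ suc)))
    where
    cover : image f ⊆ single (f zero) ∪ image (f ∘ suc)
    cover h with ∈-image⁻ f h
    ... | zero  , refl = ∪⁺ˡ (single-∋ (f zero))
    ... | suc i , refl = ∪⁺ʳ {P = single (f zero)} (∈-image⁺ (f ∘ suc) i)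
  at-least : ∀ {d} (f : Fin d → Fin n) → Injective _≡_ _≡_ f → d ≤ size (image f)
  at-least {d = zero}  f _   = z≤n
  at-least {d = suc d} f inj =
    ≤-trans (s≤s (at-least (f ∘ suc) (Fin.suc-injective ∘ inj))) (size-⊂ shift (∈-image⁺ f zero) f₀∉)
    where
    shift : image (f ∘ suc) ⊆ image f
    shift h with ∈-image⁻ (f ∘ suc) h
    ... | i , refl = ∈-image⁺ f (suc i)
    f₀∉ : f zero ∉ image (f ∘ suc)
    f₀∉ with ∈-or-∉ (image (f ∘ suc)) (f zero)
    ... | inj₂ ∉ = ∉
    ... | inj₁ ∈ with ∈-image⁻ (f ∘ suc) ∈
    ...   | i , eq = case inj eq of λ ()

size-↑ : ∀ p {q} (P : VSet (p + q)) → size P ≡ size (P ∘ (_↑ˡ q)) + size (P ∘ (p ↑ʳ_))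
size-↑ zero        P = refl
size-↑ (suc p) {q} P = begin
  size P                                                     ≡⟨ size-suc P ⟩
  χ (P zero) + size (P ∘ suc)                                ≡⟨ cong (χ (P zero) +_) (size-↑ p (P ∘ suc)) ⟩
  χ (P zero) + (size (P ∘ suc ∘ (_↑ˡ q)) + size right)       ≡⟨ +-assoc (χ (P zero)) _ _ ⟨
  χ (P zero) + size (P ∘ suc ∘ (_↑ˡ q)) + size right         ≡⟨ cong (_+ size right) (size-suc (P ∘ (_↑ˡ q))) ⟨
  size (P ∘ (_↑ˡ q)) + size right                            ∎
  where
  open ≡-Reasoning
  right = P ∘ (suc p ↑ʳ_)

size-splitAt : ∀ p {q} (P : Fin p ⊎ Fin q → Bool) → size (P ∘ splitAt p) ≡ size (P ∘ inj₁) + size (P ∘ inj₂)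
size-splitAt p {q} P = trans (size-↑ p (P ∘ splitAt p))
  (cong₂ _+_ (size-cong λ x → cong P (splitAt-↑ˡ p x q)) (size-cong λ y → cong P (splitAt-↑ʳ p q y)))

size-Defs-∩ : (P Q : VSet n) → size (P Defs.∩ Q) ≡ size (P ∩ Q)
size-Defs-∩ P Q = size-cong λ v → trans (if≡∧ (P v)) (sym (∩-apply P Q v))
  where
  if≡∧ : ∀ b {c} → (if b then c else false) ≡ b ∧ c
  if≡∧ true  = refl
  if≡∧ false = refl

-- Bootstrap percolation

≤ᵇ-sound : ∀ r k → (r ≤ᵇ k) ≡ true → r ≤ k
≤ᵇ-sound zero    k       _ = z≤n
≤ᵇ-sound (suc r) (suc k) h = s≤s (≤ᵇ-sound r k h)

module Bootstrap {n} (G : Graph n) (r : ℕ) where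

  infection-step : VSet n → VSet n
  infection-step I v = I v ∨ (r ≤ᵇ size (nbhd G v Defs.∩ I))

  ⊆-infection-step : ∀ {I} → I ⊆ infection-step I
  ⊆-infection-step {I} {v} (∈-intro v∈I) = ∈-intro (cong (_∨ (r ≤ᵇ size (nbhd G v Defs.∩ I))) v∈I)

  newly-infected : ∀ {I v} → v ∈ infection-step I → v ∉ I → r ≤ size (nbhd G v ∩ I)
  newly-infected {I} {v} (∈-intro h) (∉-intro v∉I) = subst (r ≤_) (size-Defs-∩ (nbhd G v) I)
    (≤ᵇ-sound r _ (subst (λ b → b ∨ (r ≤ᵇ size (nbhd G v Defs.∩ I)) ≡ true) v∉I h))

  bootstrap-⊆-+ : ∀ {A} t k → bootstrap G r A t ⊆ bootstrap G r A (k + t)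
  bootstrap-⊆-+ t zero    = λ h → h
  bootstrap-⊆-+ t (suc k) = ⊆-infection-step ∘ bootstrap-⊆-+ t k

  bootstrap-mono : ∀ {A t t'} → t ≤ t' → bootstrap G r A t ⊆ bootstrap G r A t'
  bootstrap-mono {A} {t} {t'} t≤t' h =
    subst (λ s → _ ∈ bootstrap G r A s) (m∸n+n≡m t≤t') (bootstrap-⊆-+ t (t' ∸ t) h)

  -- The sum of the individual infection times is a common one.
  percolates⇒infected-at : ∀ {A} → Percolates G r A → ∃ λ T → ∀ v → v ∈ bootstrap G r A T
  percolates⇒infected-at perc = sum time , λ v → bootstrap-mono (term≤∑ time v) (∈-intro (proj₂ (perc v)))
    where time = λ v → proj₁ (perc v)

  Closed : VSet n → Set
  Closed B = ∀ {v} → v ∉ B → size (nbhd G v ∩ B) < r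

  bootstrap-⊆-closed : ∀ {A B} → A ⊆ B → Closed B → ∀ t → bootstrap G r A t ⊆ B
  bootstrap-⊆-closed A⊆B closed zero h = A⊆B h
  bootstrap-⊆-closed {A} {B} A⊆B closed (suc t) {v} h with ∈-or-∉ (bootstrap G r A t) v | ∈-or-∉ B v
  ... | inj₁ v∈I | _       = bootstrap-⊆-closed A⊆B closed t v∈I
  ... | inj₂ _   | inj₁ v∈B = v∈B
  ... | inj₂ v∉I | inj₂ v∉B = ⊥-elim (<⇒≱ (closed v∉B) (≤-trans (newly-infected h v∉I) (size-mono I⊆B)))
    where
    I⊆B : nbhd G v ∩ bootstrap G r A t ⊆ nbhd G v ∩ B
    I⊆B w∈ = ∩⁺ (∩⁻ˡ w∈) (bootstrap-⊆-closed A⊆B closed t (∩⁻ʳ w∈))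

  percolates-⊆-closed : ∀ {A B} → Percolates G r A → A ⊆ B → Closed B → ∀ v → v ∈ B
  percolates-⊆-closed perc A⊆B closed v =
    bootstrap-⊆-closed A⊆B closed (proj₁ (perc v)) (∈-intro (proj₂ (perc v)))

-- Graphs split into two parts

side : (Fin n → Bool) → Bool → VSet n
side part σ v = does (part v ≟ᵇ σ)

cross : Graph n → (Fin n → Bool) → Fin n → VSet n
cross G part v = nbhd G v ∩ side part (not (part v))

module TwoParts {n} (G : Graph n) (part : Fin n → Bool) (d : ℕ)
  (cross-degree : ∀ v → size (cross G part v) ≤ d)
  (C₄-free : ∀ {u u' w w'} → part u ≡ true →
             w ∈ cross G part u → w' ∈ cross G part u → w ∈ cross G part u' → w' ∈ cross G part u' →
             u ≡ u' ⊎ w ≡ w')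
  (side-large : ∀ σ → d + 3 ≤ size (side part σ))
  where

  open Bootstrap G (d + 3)

  Side : Bool → VSet n
  Side = side part

  Cross : Fin n → VSet n
  Cross = cross G part

  ∈-Side⁺ : ∀ {σ v} → part v ≡ σ → v ∈ Side σ
  ∈-Side⁺ {σ} {v} eq = ∈-intro (dec-true (part v ≟ᵇ σ) eq)

  ∈-Side⁻ : ∀ {σ v} → v ∈ Side σ → part v ≡ σ
  ∈-Side⁻ {σ} {v} (∈-intro h) = true⇒witness (part v ≟ᵇ σ) h

  Side-not : ∀ σ v → Side (not σ) v ≡ not (Side σ v)
  Side-not σ v with part v | σ
  ... | true  | true  = refl
  ... | true  | false = refl
  ... | false | true  = refl
  ... | false | false = refl

  ∉-Side⁻ : ∀ {σ v} → v ∉ Side σ → part v ≡ not σ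
  ∉-Side⁻ {σ} {v} (∉-intro h) = ∈-Side⁻ (∈-intro (trans (Side-not σ v) (cong not h)))

  ∈-Cross⁻ : ∀ {v w} → w ∈ Cross v → adj G v w ≡ true × part w ≡ not (part v)
  ∈-Cross⁻ h = ∈-elim (∩⁻ˡ h) , ∈-Side⁻ (∩⁻ʳ h)

  across : ∀ {σ v w} → part v ≡ σ → w ∈ Cross v → part w ≡ not σ
  across pv w∈ = trans (proj₂ (∈-Cross⁻ w∈)) (cong not pv)

  Cross-sym : ∀ {v w} → w ∈ Cross v → v ∈ Cross w
  Cross-sym {v} {w} h with ∈-Cross⁻ h
  ... | vw , pw = ∩⁺ (∈-intro (trans (Graph.sym G w v) vw))
                     (∈-Side⁺ (trans (sym (not-involutive (part v))) (cong not (sym pw))))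

  common-Cross≤1 : ∀ {u u'} → u ≢ u' → size (Cross u ∩ Cross u') ≤ 1
  common-Cross≤1 {u} {u'} u≢u' = size≤1 common
    where
    common : ∀ {w w'} → w ∈ Cross u ∩ Cross u' → w' ∈ Cross u ∩ Cross u' → w ≡ w'
    common h h' with ∩⁻ h | ∩⁻ h' | part u in pu
    ... | uw , u'w | uw' , u'w' | true  = [ ⊥-elim ∘ u≢u' , (λ eq → eq) ]′ (C₄-free pu uw uw' u'w u'w')
    ... | uw , u'w | uw' , u'w' | false = [ (λ eq → eq) , ⊥-elim ∘ u≢u' ]′
      (C₄-free (across pu uw)
               (Cross-sym uw) (Cross-sym u'w) (Cross-sym uw') (Cross-sym u'w'))

  nbhd-count : ∀ v X → size (nbhd G v ∩ X) ≤ size (X ∩ Side (part v)) + size (Cross v ∩ X)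
  nbhd-count v X = size-⊆-∪ split
    where
    split : nbhd G v ∩ X ⊆ X ∩ Side (part v) ∪ Cross v ∩ X
    split {w} h with part w ≟ᵇ part v
    ... | yes same = ∪⁺ˡ (∩⁺ (∩⁻ʳ h) (∈-Side⁺ same))
    ... | no  diff = ∪⁺ʳ {P = X ∩ Side (part v)} (∩⁺ (∩⁺ (∩⁻ˡ h) (∈-Side⁺ (¬-not diff))) (∩⁻ʳ h))

  share : VSet n → Bool → ℕ
  share A σ = size (A ∩ Side σ)

  share-sum : ∀ A σ → share A σ + share A (not σ) ≡ size A
  share-sum A σ = trans (cong (share A σ +_) (size-cong complement)) (size-∩-∖ A (Side σ))
    where
    complement : ∀ v → (A ∩ Side (not σ)) v ≡ (A ∖ Side σ) v
    complement v = trans (∩-apply A (Side (not σ)) v)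
                     (trans (cong (A v ∧_) (Side-not σ v)) (sym (∖-apply A (Side σ) v)))

  sparse-closed : ∀ {A} → size A < d + 3 → Closed A
  sparse-closed {A} A<r {v} _ = ≤-<-trans (size-mono {P = nbhd G v ∩ A} ∩⁻ʳ) A<r

  thin-closed : ∀ {A σ} → share A σ ≤ 2 → Closed (A ∪ Side (not σ))
  thin-closed {A} {σ} thin {v} v∉B = begin-strict
    size (nbhd G v ∩ B)                              ≤⟨ nbhd-count v B ⟩
    size (B ∩ Side (part v)) + size (Cross v ∩ B)    ≤⟨ +-mono-≤ (size-mono B-on-σ) (size-mono Cv∩B⊆Cv) ⟩
    share A σ + size (Cross v)                       ≤⟨ +-mono-≤ thin (cross-degree v) ⟩
    2 + d                                            <⟨ +-monoˡ-< d (n<1+n 2) ⟩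
    3 + d                                            ≡⟨ +-comm 3 d ⟩
    d + 3                                            ∎
    where
    open ≤-Reasoning
    B = A ∪ Side (not σ)
    Cv∩B⊆Cv : Cross v ∩ B ⊆ Cross v
    Cv∩B⊆Cv = ∩⁻ˡ
    v-on-σ : part v ≡ σ
    v-on-σ with ∈-or-∉ (Side (not σ)) v
    ... | inj₁ v∈ = ⊥-elim (∈∉-contra (∪⁺ʳ {P = A} v∈) v∉B)
    ... | inj₂ v∉ = trans (∉-Side⁻ v∉) (not-involutive σ)
    B-on-σ : B ∩ Side (part v) ⊆ A ∩ Side σ
    B-on-σ h with ∩⁻ h
    ... | w∈B , w∈Sv with ∪⁻ w∈B
    ...   | inj₁ w∈A  = ∩⁺ w∈A (∈-Side⁺ (trans (∈-Side⁻ w∈Sv) v-on-σ))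
    ...   | inj₂ w∈¬σ = ⊥-elim (not-¬ (trans (∈-Side⁻ w∈Sv) v-on-σ) (∈-Side⁻ w∈¬σ))

  module Balanced (A : VSet n) (size-A : size A ≡ d + 3) (share≥3 : ∀ σ → 3 ≤ share A σ) where

    a : Bool → ℕ
    a = share A

    a-sum : ∀ σ → a σ + a (not σ) ≡ d + 3
    a-sum σ = trans (share-sum A σ) size-A

    extras : VSet n → Bool → VSet n
    extras I σ = I ∩ Side σ ∖ A

    NoExtra : VSet n → Bool → Set
    NoExtra I σ = ∀ {u} → u ∈ extras I σ → ⊥

    extras⁺ : ∀ {I σ u} → u ∈ I → part u ≡ σ → u ∉ A → u ∈ extras I σ
    extras⁺ u∈I pu u∉A = ∖⁺ (∩⁺ u∈I (∈-Side⁺ pu)) u∉A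

    extras⁻ : ∀ {I σ u} → u ∈ extras I σ → u ∈ I × part u ≡ σ × u ∉ A
    extras⁻ h with ∖⁻ h
    ... | u∈I∩S , u∉A = ∩⁻ˡ u∈I∩S , ∈-Side⁻ (∩⁻ʳ u∈I∩S) , u∉A

    A-or-extra : ∀ {I σ w} → w ∈ I → part w ≡ σ → w ∈ A ⊎ w ∈ extras I σ
    A-or-extra {w = w} w∈I pw with ∈-or-∉ A w
    ... | inj₁ w∈A = inj₁ w∈A
    ... | inj₂ w∉A = inj₂ (extras⁺ w∈I pw w∉A)

    crowded : ∀ {σ w z} → A ∩ Side σ ⊆ Cross w → z ∈ Cross w → z ∉ A → a σ < d
    crowded {w = w} A⊆ z∈ z∉A = <-≤-trans (size-⊂ A⊆ z∈ (∉-∩ˡ z∉A)) (cross-degree w)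

    opposite-in-A : ∀ {I σ v} → part v ≡ σ → NoExtra I (not σ) → Cross v ∩ I ⊆ A
    opposite-in-A pv none h with A-or-extra (∩⁻ʳ h) (across pv (∩⁻ˡ h))
    ... | inj₁ w∈A = w∈A
    ... | inj₂ w∈E = ⊥-elim (none w∈E)

    fill-opposite : ∀ {I σ v} → part v ≡ σ → Cross v ∩ I ⊆ A → a (not σ) ≤ size (Cross v ∩ I) →
                    A ∩ Side (not σ) ⊆ Cross v
    fill-opposite {I} {σ} {v} pv ⊆A many = ∩⁻ˡ ∘ size-≤⇒⊇ inside many
      where
      inside : Cross v ∩ I ⊆ A ∩ Side (not σ)
      inside h = ∩⁺ (⊆A h) (∈-Side⁺ (across pv (∩⁻ˡ h)))

    newcomers : VSet n → Bool → VSet n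
    newcomers I σ = (infection-step I ∖ I) ∩ Side σ

    newcomers⁻ : ∀ {I σ u} → u ∈ newcomers I σ → u ∈ infection-step I × u ∉ I × part u ≡ σ
    newcomers⁻ h with ∖⁻ (∩⁻ˡ h)
    ... | u∈I' , u∉I = u∈I' , u∉I , ∈-Side⁻ (∩⁻ʳ h)

    record Invariant (I : VSet n) : Set where
      field
        A⊆I          : A ⊆ I
        extra-unique : ∀ {σ u u'} → u ∈ extras I σ → u' ∈ extras I σ → u ≡ u'
        extra-sees   : ∀ {σ u} → u ∈ extras I σ → a (not σ) ≤ size (Cross u ∩ I)
        -- Of two adjacent extras, the one infected first saw all of A on the other side.
        extra-pair   : ∀ {σ x y} → x ∈ extras I σ → y ∈ extras I (not σ) → y ∈ Cross x →
                       A ∩ Side (not σ) ⊆ Cross x ⊎ A ∩ Side σ ⊆ Cross y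

    initial : Invariant A
    initial = record
      { A⊆I          = λ h → h
      ; extra-unique = λ h _ → ⊥-elim (no-extra h)
      ; extra-sees   = λ h → ⊥-elim (no-extra h)
      ; extra-pair   = λ h _ _ → ⊥-elim (no-extra h)
      }
      where
      no-extra : ∀ {σ u} → u ∈ extras A σ → ⊥
      no-extra h with extras⁻ h
      ... | u∈A , _ , u∉A = ∈∉-contra u∈A u∉A

    module Step (I : VSet n) (inv : Invariant I) where

      open Invariant inv

      side-bound : ∀ σ → size (I ∩ Side σ) ≤ a σ + 1
      side-bound σ = ≤-trans (size-⊆-∪ split) (+-monoʳ-≤ (a σ) (size≤1 extra-unique))
        where
        split : I ∩ Side σ ⊆ A ∩ Side σ ∪ extras I σ
        split h with A-or-extra (∩⁻ˡ h) (∈-Side⁻ (∩⁻ʳ h))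
        ... | inj₁ w∈A = ∪⁺ˡ (∩⁺ w∈A (∩⁻ʳ h))
        ... | inj₂ w∈E = ∪⁺ʳ {P = A ∩ Side σ} w∈E

      no-extra-bound : ∀ {σ} → NoExtra I σ → size (I ∩ Side σ) ≤ a σ
      no-extra-bound {σ} none = size-mono only-A
        where
        only-A : I ∩ Side σ ⊆ A ∩ Side σ
        only-A h with A-or-extra (∩⁻ˡ h) (∈-Side⁻ (∩⁻ʳ h))
        ... | inj₁ w∈A = ∩⁺ w∈A (∩⁻ʳ h)
        ... | inj₂ w∈E = ⊥-elim (none w∈E)

      newcomer-count : ∀ {σ u} → u ∈ newcomers I σ → d + 3 ≤ size (I ∩ Side σ) + size (Cross u ∩ I)
      newcomer-count {u = u} h with newcomers⁻ h
      ... | u∈I' , u∉I , refl = ≤-trans (newly-infected u∈I' u∉I) (nbhd-count u I)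

      pair-count : ∀ {σ u u'} → u ≢ u' → part u ≡ σ → part u' ≡ σ →
                   size (Cross u ∩ I) + size (Cross u' ∩ I) ≤ a (not σ) + 1 + 1
      pair-count {σ} {u} {u'} u≢u' pu pu' = begin
        size (Cross u ∩ I) + size (Cross u' ∩ I)
          ≤⟨ size-∩-overlap (opposite pu) (opposite pu') ⟩
        size (I ∩ Side (not σ)) + size ((Cross u ∩ I) ∩ (Cross u' ∩ I))
          ≤⟨ +-mono-≤ (side-bound (not σ)) (size-mono common) ⟩
        a (not σ) + 1 + size (Cross u ∩ Cross u')
          ≤⟨ +-monoʳ-≤ (a (not σ) + 1) (common-Cross≤1 u≢u') ⟩
        a (not σ) + 1 + 1
          ∎
        where
        open ≤-Reasoning
        opposite : ∀ {v} → part v ≡ σ → Cross v ∩ I ⊆ I ∩ Side (not σ)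
        opposite pv h = ∩⁺ (∩⁻ʳ h) (∈-Side⁺ (across pv (∩⁻ˡ h)))
        common : (Cross u ∩ I) ∩ (Cross u' ∩ I) ⊆ Cross u ∩ Cross u'
        common h = ∩⁺ (∩⁻ˡ (∩⁻ˡ h)) (∩⁻ˡ (∩⁻ʳ h))

      newcomer-sees : ∀ {σ u} → u ∈ newcomers I σ → NoExtra I σ → a (not σ) ≤ size (Cross u ∩ I)
      newcomer-sees {σ} {u} h none = +-cancelˡ-≤ (a σ) _ _ (begin
        a σ + a (not σ)                          ≡⟨ a-sum σ ⟩
        d + 3                                    ≤⟨ newcomer-count h ⟩
        size (I ∩ Side σ) + size (Cross u ∩ I)   ≤⟨ +-monoˡ-≤ _ (no-extra-bound none) ⟩
        a σ + size (Cross u ∩ I)                 ∎)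
        where open ≤-Reasoning

      module SecondExtra {σ x u} (x∈ : x ∈ extras I σ) (u∈ : u ∈ newcomers I σ) where

        b : ℕ
        b = a (not σ)

        x∈I : x ∈ I
        x∈I = proj₁ (extras⁻ x∈)

        px : part x ≡ σ
        px = proj₁ (proj₂ (extras⁻ x∈))

        x∉A : x ∉ A
        x∉A = proj₂ (proj₂ (extras⁻ x∈))

        u∉I : u ∉ I
        u∉I = proj₁ (proj₂ (newcomers⁻ u∈))

        pu : part u ≡ σ
        pu = proj₂ (proj₂ (newcomers⁻ u∈))

        u∉A : u ∉ A
        u∉A with ∈-or-∉ A u
        ... | inj₁ u∈A = ⊥-elim (∈∉-contra (A⊆I u∈A) u∉I)
        ... | inj₂ u∉A = u∉A

        x≢u : x ≢ u
        x≢u refl = ∈∉-contra x∈I u∉I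

        u-sees : b ≤ 1 + size (Cross u ∩ I)
        u-sees = +-cancelˡ-≤ (a σ) _ _ (begin
          a σ + b                                  ≡⟨ a-sum σ ⟩
          d + 3                                    ≤⟨ newcomer-count u∈ ⟩
          size (I ∩ Side σ) + size (Cross u ∩ I)   ≤⟨ +-monoˡ-≤ _ (side-bound σ) ⟩
          a σ + 1 + size (Cross u ∩ I)             ≡⟨ +-assoc (a σ) 1 _ ⟩
          a σ + (1 + size (Cross u ∩ I))           ∎)
          where open ≤-Reasoning

        u-sees-two : 2 ≤ size (Cross u ∩ I)
        u-sees-two = s≤s⁻¹ (≤-trans (share≥3 (not σ)) u-sees)

        -- x and u see b and b - 1 infected vertices across, at most one of them in common.
        d≤a : d ≤ a σ
        d≤a = +-cancelʳ-≤ 3 d (a σ) (begin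
          d + 3     ≡⟨ a-sum σ ⟨
          a σ + b   ≤⟨ +-monoʳ-≤ (a σ) b≤3 ⟩
          a σ + 3   ∎)
          where
          open ≤-Reasoning
          b≤3 : b ≤ 3
          b≤3 = +-cancelˡ-≤ b b 3 (begin
            b + b                                          ≤⟨ +-mono-≤ (extra-sees x∈) u-sees ⟩
            size (Cross x ∩ I) + suc (size (Cross u ∩ I))  ≡⟨ +-suc _ _ ⟩
            suc (size (Cross x ∩ I) + size (Cross u ∩ I))  ≤⟨ s≤s (pair-count x≢u px pu) ⟩
            suc (b + 1 + 1)                                ≡⟨ cong suc (+-assoc b 1 1) ⟩
            suc (b + 2)                                    ≡⟨ +-suc b 2 ⟨
            b + 3                                          ∎)

        overfull : ∀ {w z} → A ∩ Side σ ⊆ Cross w → z ∈ Cross w → z ∉ A → ⊥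
        overfull A⊆ z∈ z∉A = <⇒≱ (crowded A⊆ z∈ z∉A) d≤a

        extra-neighbour : ∀ {w} → w ∈ Cross x → w ∈ extras I (not σ) → ⊥
        extra-neighbour {w} w∈Cx w-extra with extra-pair x∈ w-extra w∈Cx
        ... | inj₂ A⊆Cw = overfull A⊆Cw (Cross-sym w∈Cx) x∉A
        ... | inj₁ A⊆Cx = <⇒≱ u-sees-two (≤-trans (size-mono covered) (common-Cross≤1 (x≢u ∘ sym)))
          where
          covered : Cross u ∩ I ⊆ Cross u ∩ Cross x
          covered h with A-or-extra (∩⁻ʳ h) (across pu (∩⁻ˡ h))
          ... | inj₁ w'∈A = ∩⁺ (∩⁻ˡ h) (A⊆Cx (∩⁺ w'∈A (∈-Side⁺ (across pu (∩⁻ˡ h)))))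
          ... | inj₂ w'∈E rewrite extra-unique w'∈E w-extra = ∩⁺ (∩⁻ˡ h) w∈Cx

        only-A-neighbours : Cross x ∩ I ⊆ A → ⊥
        only-A-neighbours ⊆A = overfull A⊆Cw (Cross-sym (∩⁻ˡ w∈CuI)) u∉A
          where
          A⊆Cx : A ∩ Side (not σ) ⊆ Cross x
          A⊆Cx = fill-opposite px ⊆A (extra-sees x∈)
          fresh : ∃ λ w → w ∈ Cross u ∩ I × w ∉ Cross u ∩ Cross x
          fresh = size-<⇒⊈ (≤-<-trans (common-Cross≤1 (x≢u ∘ sym)) u-sees-two)
          w = proj₁ fresh
          w∈CuI = proj₁ (proj₂ fresh)
          pw : part w ≡ not σ
          pw = across pu (∩⁻ˡ w∈CuI)
          w∉Cx : w ∉ Cross x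
          w∉Cx with ∈-or-∉ (Cross x) w
          ... | inj₁ w∈Cx = ⊥-elim (∈∉-contra (∩⁺ (∩⁻ˡ w∈CuI) w∈Cx) (proj₂ (proj₂ fresh)))
          ... | inj₂ w∉Cx = w∉Cx
          w∉A : w ∉ A
          w∉A with ∈-or-∉ A w
          ... | inj₁ w∈A = ⊥-elim (∈∉-contra (A⊆Cx (∩⁺ w∈A (∈-Side⁺ pw))) w∉Cx)
          ... | inj₂ w∉A = w∉A
          Cw⊆A : Cross w ∩ I ⊆ A
          Cw⊆A h with A-or-extra (∩⁻ʳ h) (trans (across pw (∩⁻ˡ h)) (not-involutive σ))
          ... | inj₁ z∈A = z∈A
          ... | inj₂ z∈E rewrite extra-unique z∈E x∈ = ⊥-elim (∈∉-contra (Cross-sym (∩⁻ˡ h)) w∉Cx)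
          A⊆Cw : A ∩ Side σ ⊆ Cross w
          A⊆Cw = subst (λ τ → A ∩ Side τ ⊆ Cross w) (not-involutive σ)
                   (fill-opposite pw Cw⊆A (extra-sees (extras⁺ (∩⁻ʳ w∈CuI) pw w∉A)))

        impossible : ⊥
        impossible with ⊆? (Cross x ∩ I) A
        ... | inj₁ ⊆A = only-A-neighbours ⊆A
        ... | inj₂ (w , w∈ , w∉A) =
          extra-neighbour (∩⁻ˡ w∈) (extras⁺ (∩⁻ʳ w∈) (across px (∩⁻ˡ w∈)) w∉A)

      newcomer⇒no-extra : ∀ {σ u} → u ∈ newcomers I σ → NoExtra I σ
      newcomer⇒no-extra u∈ x∈ = SecondExtra.impossible x∈ u∈

      newcomers-unique : ∀ {σ u u'} → u ∈ newcomers I σ → u' ∈ newcomers I σ → u ≡ u'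
      newcomers-unique {σ} {u} {u'} u∈ u'∈ with u ≟ᶠ u'
      ... | yes u≡u' = u≡u'
      ... | no  u≢u' = ⊥-elim (<⇒≱ (share≥3 (not σ)) (+-cancelˡ-≤ b b 2 (begin
        b + b                                      ≤⟨ +-mono-≤ (newcomer-sees u∈ none) (newcomer-sees u'∈ none) ⟩
        size (Cross u ∩ I) + size (Cross u' ∩ I)   ≤⟨ pair-count u≢u' (on-side u∈) (on-side u'∈) ⟩
        b + 1 + 1                                  ≡⟨ +-assoc b 1 1 ⟩
        b + 2                                      ∎)))
        where
        open ≤-Reasoning
        b = a (not σ)
        none = newcomer⇒no-extra u∈
        on-side : ∀ {v} → v ∈ newcomers I σ → part v ≡ σ
        on-side = proj₂ ∘ proj₂ ∘ newcomers⁻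

      classify : ∀ {σ u} → u ∈ extras (infection-step I) σ → u ∈ extras I σ ⊎ u ∈ newcomers I σ
      classify {u = u} h with extras⁻ h | ∈-or-∉ I u
      ... | _    , pu , u∉A | inj₁ u∈I = inj₁ (extras⁺ u∈I pu u∉A)
      ... | u∈I' , pu , _   | inj₂ u∉I = inj₂ (∩⁺ (∖⁺ u∈I' u∉I) (∈-Side⁺ pu))

      sees-before : ∀ {σ u} → u ∈ extras (infection-step I) σ → a (not σ) ≤ size (Cross u ∩ I)
      sees-before h with classify h
      ... | inj₁ old = extra-sees old
      ... | inj₂ new = newcomer-sees new (newcomer⇒no-extra new)

      step : Invariant (infection-step I)
      step = record
        { A⊆I          = ⊆-infection-step ∘ A⊆I
        ; extra-unique = unique
        ; extra-sees   = λ h → ≤-trans (sees-before h) (size-mono grow)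
        ; extra-pair   = pair
        }
        where
        grow : ∀ {u} → Cross u ∩ I ⊆ Cross u ∩ infection-step I
        grow w∈ = ∩⁺ (∩⁻ˡ w∈) (⊆-infection-step (∩⁻ʳ w∈))

        unique : ∀ {σ u u'} → u ∈ extras (infection-step I) σ → u' ∈ extras (infection-step I) σ → u ≡ u'
        unique h h' with classify h | classify h'
        ... | inj₁ old | inj₁ old' = extra-unique old old'
        ... | inj₁ old | inj₂ new' = ⊥-elim (newcomer⇒no-extra new' old)
        ... | inj₂ new | inj₁ old' = ⊥-elim (newcomer⇒no-extra new old')
        ... | inj₂ new | inj₂ new' = newcomers-unique new new'

        pair : ∀ {σ x y} → x ∈ extras (infection-step I) σ → y ∈ extras (infection-step I) (not σ) →
               y ∈ Cross x → A ∩ Side (not σ) ⊆ Cross x ⊎ A ∩ Side σ ⊆ Cross y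
        pair {σ} {x} {y} hx hy y∈Cx with classify hx | classify hy
        ... | _          | inj₂ new-y =
          inj₁ (fill-opposite px (opposite-in-A px (newcomer⇒no-extra new-y)) (sees-before hx))
          where px = proj₁ (proj₂ (extras⁻ hx))
        ... | inj₂ new-x | inj₁ _     = inj₂ (subst (λ τ → A ∩ Side τ ⊆ Cross y) (not-involutive σ)
                                                (fill-opposite py (opposite-in-A py none) (sees-before hy)))
          where
          py = proj₁ (proj₂ (extras⁻ hy))
          none = subst (NoExtra I) (sym (not-involutive σ)) (newcomer⇒no-extra new-x)
        ... | inj₁ old-x | inj₁ old-y = extra-pair old-x old-y y∈Cx

    invariant : ∀ t → Invariant (bootstrap G (d + 3) A t)
    invariant zero    = initial
    invariant (suc t) = Step.step (bootstrap G (d + 3) A t) (invariant t)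

    not-percolating : ¬ Percolates G (d + 3) A
    not-percolating perc = <⇒≱ (+-monoʳ-< (a true) (≤-trans (s≤s (s≤s z≤n)) (share≥3 false))) (begin
      a true + a false       ≡⟨ a-sum true ⟩
      d + 3                  ≤⟨ side-large true ⟩
      size (Side true)       ≤⟨ size-mono (∩⁺ (all-infected _)) ⟩
      size (I ∩ Side true)   ≤⟨ Step.side-bound I (invariant T) true ⟩
      a true + 1             ∎)
      where
      open ≤-Reasoning
      T = proj₁ (percolates⇒infected-at perc)
      I = bootstrap G (d + 3) A T
      all-infected = proj₂ (percolates⇒infected-at perc)

  sparse-not-percolating : ∀ {A} → size A < d + 3 → ¬ Percolates G (d + 3) A
  sparse-not-percolating {A} small perc =
    <⇒≱ small (≤-trans (side-large true) (size-mono λ {v} _ → all∈A v))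
    where
    all∈A = percolates-⊆-closed perc (λ h → h) (sparse-closed small)

  thin-not-percolating : ∀ {A σ} → share A σ ≤ 2 → ¬ Percolates G (d + 3) A
  thin-not-percolating {A} {σ} thin perc = <⇒≱ (≤-<-trans thin (m≤n+m 3 d)) (begin
    d + 3           ≤⟨ side-large σ ⟩
    size (Side σ)   ≤⟨ size-mono side⊆A ⟩
    share A σ       ∎)
    where
    open ≤-Reasoning
    all∈B = percolates-⊆-closed perc ∪⁺ˡ (thin-closed thin)
    side⊆A : Side σ ⊆ A ∩ Side σ
    side⊆A {v} h with ∪⁻ (all∈B v)
    ... | inj₁ v∈A  = ∩⁺ v∈A h
    ... | inj₂ v∈¬σ = ⊥-elim (not-¬ (∈-Side⁻ h) (∈-Side⁻ v∈¬σ))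

  m>d+3 : mGreaterThan G (d + 3) (d + 3)
  m>d+3 A perc with d + 3 <? size A
  ... | yes big = big
  ... | no ¬big with m≤n⇒m<n∨m≡n (≮⇒≥ ¬big)
  ...   | inj₁ small = ⊥-elim (sparse-not-percolating small perc)
  ...   | inj₂ exact with 3 ≤? share A true | 3 ≤? share A false
  ...     | no thin | _       = ⊥-elim (thin-not-percolating (≤-pred (≰⇒> thin)) perc)
  ...     | yes _   | no thin = ⊥-elim (thin-not-percolating (≤-pred (≰⇒> thin)) perc)
  ...     | yes t   | yes f   = ⊥-elim (Balanced.not-percolating A exact (λ { true → t ; false → f }) perc)

-- Two cliques joined by a bipartite graph

splitAt-injective : ∀ p {q} {v w : Fin (p + q)} → splitAt p v ≡ splitAt p w → v ≡ w
splitAt-injective p {q} {v} {w} eq =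
  trans (sym (join-splitAt p q v)) (trans (cong (join p q) eq) (join-splitAt p q w))

module TwoCliques {p q : ℕ} (H : Fin p → Fin q → Bool) where

  adjacency : Fin p ⊎ Fin q → Fin p ⊎ Fin q → Bool
  adjacency (inj₁ x) (inj₁ x') = not (single x x')
  adjacency (inj₂ y) (inj₂ y') = not (single y y')
  adjacency (inj₁ x) (inj₂ y)  = H x y
  adjacency (inj₂ y) (inj₁ x)  = H x y

  adjacency-sym : ∀ a b → adjacency a b ≡ adjacency b a
  adjacency-sym (inj₁ x) (inj₁ x') = cong not (single-sym x x')
  adjacency-sym (inj₂ y) (inj₂ y') = cong not (single-sym y y')
  adjacency-sym (inj₁ x) (inj₂ y)  = refl
  adjacency-sym (inj₂ y) (inj₁ x)  = refl

  adjacency-irrefl : ∀ a → adjacency a a ≡ false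
  adjacency-irrefl (inj₁ x) = cong not (∈-elim (single-∋ x))
  adjacency-irrefl (inj₂ y) = cong not (∈-elim (single-∋ y))

  graph : Graph (p + q)
  graph = record
    { adj    = λ v w → adjacency (splitAt p v) (splitAt p w)
    ; sym    = λ v w → adjacency-sym (splitAt p v) (splitAt p w)
    ; irrefl = λ v → adjacency-irrefl (splitAt p v)
    }

  left? : Fin p ⊎ Fin q → Bool
  left? = [ (λ _ → true) , (λ _ → false) ]′

  part : Fin (p + q) → Bool
  part v = left? (splitAt p v)

  column : Fin q → VSet p
  column y x = H x y

  splitAt-view : ∀ v → (∃ λ (x : Fin p) → splitAt p v ≡ inj₁ x) ⊎ (∃ λ (y : Fin q) → splitAt p v ≡ inj₂ y)
  splitAt-view v with splitAt p v
  ... | inj₁ x = inj₁ (x , refl)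
  ... | inj₂ y = inj₂ (y , refl)

  degree-at : ∀ {v a} → splitAt p v ≡ a → deg graph v ≡ size (adjacency a ∘ inj₁) + size (adjacency a ∘ inj₂)
  degree-at {v} refl = size-splitAt p (adjacency (splitAt p v))

  degree-left : ∀ {v x} → splitAt p v ≡ inj₁ x → deg graph v + 1 ≡ p + size (H x)
  degree-left {v} {x} eq = begin
    deg graph v + 1                          ≡⟨ cong (_+ 1) (degree-at eq) ⟩
    size (not ∘ single x) + size (H x) + 1   ≡⟨ xy∙z≈xz∙y (size (not ∘ single x)) (size (H x)) 1 ⟩
    size (not ∘ single x) + 1 + size (H x)   ≡⟨ cong (_+ size (H x)) (size-others x) ⟩
    p + size (H x)                           ∎
    where open ≡-Reasoning

  degree-right : ∀ {v y} → splitAt p v ≡ inj₂ y → deg graph v + 1 ≡ q + size (column y)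
  degree-right {v} {y} eq = begin
    deg graph v + 1                                 ≡⟨ cong (_+ 1) (degree-at eq) ⟩
    size (column y) + size (not ∘ single y) + 1     ≡⟨ +-assoc (size (column y)) _ 1 ⟩
    size (column y) + (size (not ∘ single y) + 1)   ≡⟨ cong (size (column y) +_) (size-others y) ⟩
    size (column y) + q                             ≡⟨ +-comm (size (column y)) q ⟩
    q + size (column y)                             ∎
    where open ≡-Reasoning

  crossing : Fin p ⊎ Fin q → Fin p ⊎ Fin q → Bool
  crossing (inj₁ x) (inj₁ x') = false
  crossing (inj₂ y) (inj₂ y') = false
  crossing (inj₁ x) (inj₂ y)  = H x y
  crossing (inj₂ y) (inj₁ x)  = H x y

  cross-apply : ∀ v w → cross graph part v w ≡ crossing (splitAt p v) (splitAt p w)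
  cross-apply v w = trans (∩-apply _ _ w) (pointwise (splitAt p v) (splitAt p w))
    where
    pointwise : ∀ a b → adjacency a b ∧ does (left? b ≟ᵇ not (left? a)) ≡ crossing a b
    pointwise (inj₁ x) (inj₁ x') = ∧-zeroʳ _
    pointwise (inj₂ y) (inj₂ y') = ∧-zeroʳ _
    pointwise (inj₁ x) (inj₂ y)  = ∧-identityʳ _
    pointwise (inj₂ y) (inj₁ x)  = ∧-identityʳ _

  size-cross-at : ∀ {v a} → splitAt p v ≡ a →
                  size (cross graph part v) ≡ size (crossing a ∘ inj₁) + size (crossing a ∘ inj₂)
  size-cross-at {v} refl = trans (size-cong (cross-apply v)) (size-splitAt p (crossing (splitAt p v)))

  cross-from-left : ∀ {u w x} → splitAt p u ≡ inj₁ x → w ∈ cross graph part u →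
                    ∃ λ y → splitAt p w ≡ inj₂ y × H x y ≡ true
  cross-from-left {u} {w} eq (∈-intro h) with splitAt p w | trans (sym (cross-apply u w)) h
  ... | inj₂ y  | Hxy rewrite eq = y , refl , Hxy
  ... | inj₁ x' | h'  rewrite eq = case h' of λ ()

  cross-into-right : ∀ {u w y} → splitAt p w ≡ inj₂ y → w ∈ cross graph part u →
                     ∃ λ x → splitAt p u ≡ inj₁ x × H x y ≡ true
  cross-into-right {u} {w} eq (∈-intro h) with splitAt p u | trans (sym (cross-apply u w)) h
  ... | inj₁ x  | Hxy rewrite eq = x , refl , Hxy
  ... | inj₂ y' | h'  rewrite eq = case h' of λ ()

  size-side : ∀ σ →
              size (side part σ) ≡ size (λ (_ : Fin p) → does (true ≟ᵇ σ)) + size (λ (_ : Fin q) → does (false ≟ᵇ σ))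
  size-side σ = size-splitAt p (λ a → does (left? a ≟ᵇ σ))

  C₄-Free : Set
  C₄-Free = ∀ {x x' y y'} → H x y ≡ true → H x y' ≡ true → H x' y ≡ true → H x' y' ≡ true →
            x ≡ x' ⊎ y ≡ y'

  m>d+3 : ∀ d → (∀ x → size (H x) ≤ d) → (∀ y → size (column y) ≤ d) → C₄-Free →
          d + 3 ≤ p → d + 3 ≤ q → mGreaterThan graph (d + 3) (d + 3)
  m>d+3 d row≤ column≤ H-C₄-free d+3≤p d+3≤q = TwoParts.m>d+3 graph part d cross-degree C₄-free side-large
    where
    cross-degree : ∀ v → size (cross graph part v) ≤ d
    cross-degree v with splitAt-view v
    ... | inj₁ (x , eq) = subst (_≤ d) (sym (trans (size-cross-at eq) (cong (_+ size (H x)) (size-empty p)))) (row≤ x)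
    ... | inj₂ (y , eq) = subst (_≤ d) (sym (trans (size-cross-at eq) (trans (cong (size (column y) +_) (size-empty q))
                                                                              (+-identityʳ _)))) (column≤ y)

    C₄-free : ∀ {u u' w w'} → part u ≡ true → w ∈ cross graph part u → w' ∈ cross graph part u →
              w ∈ cross graph part u' → w' ∈ cross graph part u' → u ≡ u' ⊎ w ≡ w'
    C₄-free {u} {u'} {w} {w'} left uw uw' u'w u'w' with splitAt-view u
    ... | inj₁ (x , eu) with cross-from-left eu uw | cross-from-left eu uw'
    ...   | y , ew , Hxy | y' , ew' , Hxy' with cross-into-right ew u'w
    ...     | x' , eu' , Hx'y with cross-from-left eu' u'w'
    ...       | y'' , ew'' , Hx'y'' with inj₂-injective (trans (sym ew') ew'')
    ...         | refl with H-C₄-free Hxy Hxy' Hx'y Hx'y''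
    ...           | inj₁ refl = inj₁ (splitAt-injective p (trans eu (sym eu')))
    ...           | inj₂ refl = inj₂ (splitAt-injective p (trans ew (sym ew')))
    C₄-free left _ _ _ _ | inj₂ (y , eu) with trans (sym (cong left? eu)) left
    ...   | ()

    side-large : ∀ σ → d + 3 ≤ size (side part σ)
    side-large true  = subst (d + 3 ≤_) (sym (trans (size-side true) (trans (cong₂ _+_ (size-full p) (size-empty q))
                                                                             (+-identityʳ p)))) d+3≤p
    side-large false = subst (d + 3 ≤_) (sym (trans (size-side false) (cong₂ _+_ (size-empty p) (size-full q)))) d+3≤q

  min-degree : ∀ {d δ} → δ + 1 ≡ p + d → (∀ x → size (H x) ≡ d) → (∀ y → p + d ≤ q + size (column y)) →
               Fin p → MinDegreeIs graph δ
  min-degree {d} {δ} δ+1≡ row≡ column≥ x₀ = lower , x₀ ↑ˡ q , exact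
    where
    lower : ∀ v → δ ≤ deg graph v
    lower v with splitAt-view v
    ... | inj₁ (x , eq) = +-cancelʳ-≤ 1 δ _ (≤-reflexive (trans δ+1≡ (trans (cong (p +_) (sym (row≡ x)))
                                                                          (sym (degree-left eq)))))
    ... | inj₂ (y , eq) = +-cancelʳ-≤ 1 δ _ (≤-trans (≤-reflexive δ+1≡) (≤-trans (column≥ y)
                                                                          (≤-reflexive (sym (degree-right eq)))))
    exact : deg graph (x₀ ↑ˡ q) ≡ δ
    exact = +-cancelʳ-≡ 1 _ δ (trans (degree-left (splitAt-↑ˡ p x₀ q)) (trans (cong (p +_) (row≡ x₀)) (sym δ+1≡)))

-- Sum graphs of Sidon sets

module Translation (q : ℕ) .{{_ : NonZero q}} where

  [m%q+n]%q≡[m+n]%q : ∀ m k → (m % q + k) % q ≡ (m + k) % q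
  [m%q+n]%q≡[m+n]%q m k = begin
    (m % q + k) % q           ≡⟨ %-distribˡ-+ (m % q) k q ⟩
    (m % q % q + k % q) % q   ≡⟨ cong (λ t → (t + k % q) % q) (m%n%n≡m%n m q) ⟩
    (m % q + k % q) % q       ≡⟨ %-distribˡ-+ m k q ⟨
    (m + k) % q               ∎
    where open ≡-Reasoning

  shift : ℕ → ℕ → ℕ
  shift c k = (k + (q ∸ c)) % q

  shift< : ∀ c k → shift c k < q
  shift< c k = m%n<n (k + (q ∸ c)) q

  +-shift : ∀ {c} → c ≤ q → ∀ z → (c + z + (q ∸ c)) % q ≡ z % q
  +-shift {c} c≤q z = begin
    (c + z + (q ∸ c)) % q     ≡⟨ cong (_% q) (xy∙z≈y∙xz c z (q ∸ c)) ⟩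
    (z + (c + (q ∸ c))) % q   ≡⟨ cong (λ t → (z + t) % q) (m+[n∸m]≡n c≤q) ⟩
    (z + q) % q               ≡⟨ [m+n]%n≡m%n z q ⟩
    z % q                     ∎
    where open ≡-Reasoning

  shift-inverse : ∀ {c k} → c ≤ q → k < q → (c + shift c k) % q ≡ k
  shift-inverse {c} {k} c≤q k<q = begin
    (c + (k + (q ∸ c)) % q) % q  ≡⟨ cong (_% q) (+-comm c _) ⟩
    ((k + (q ∸ c)) % q + c) % q  ≡⟨ [m%q+n]%q≡[m+n]%q (k + (q ∸ c)) c ⟩
    (k + (q ∸ c) + c) % q        ≡⟨ cong (_% q) (xy∙z≈zx∙y k (q ∸ c) c) ⟩
    (c + k + (q ∸ c)) % q        ≡⟨ +-shift c≤q k ⟩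
    k % q                        ≡⟨ m<n⇒m%n≡m k<q ⟩
    k                            ∎
    where open ≡-Reasoning

  shift-unique : ∀ {c z k} → c ≤ q → z < q → (c + z) % q ≡ k → z ≡ shift c k
  shift-unique {c} {z} c≤q z<q refl = begin
    z                              ≡⟨ m<n⇒m%n≡m z<q ⟨
    z % q                          ≡⟨ +-shift c≤q z ⟨
    (c + z + (q ∸ c)) % q          ≡⟨ [m%q+n]%q≡[m+n]%q (c + z) (q ∸ c) ⟨
    ((c + z) % q + (q ∸ c)) % q    ∎
    where open ≡-Reasoning

  translation-injective : ∀ {c z z'} → c ≤ q → z < q → z' < q → (c + z) % q ≡ (c + z') % q → z ≡ z'
  translation-injective c≤q z<q z'<q eq = trans (shift-unique c≤q z<q eq) (sym (shift-unique c≤q z'<q refl))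

SamePair : ∀ {a} {A : Set a} → A → A → A → A → Set a
SamePair i j k l = (i ≡ k × j ≡ l) ⊎ (i ≡ l × j ≡ k)

IsSidonModulo : ∀ {d} (q : ℕ) .{{_ : NonZero q}} → (Fin d → ℕ) → Set
IsSidonModulo q g = ∀ i j k l → (g i + g j) % q ≡ (g k + g l) % q → SamePair i j k l

module Circulant (p e : ℕ) .{{_ : NonZero (p + e)}} {d : ℕ} (g : Fin d → ℕ)
  (g-injective : Injective _≡_ _≡_ g) (g< : ∀ i → g i < p + e) (g-Sidon : IsSidonModulo (p + e) g)
  where

  q : ℕ
  q = p + e

  open Translation q

  residue : ℕ → Bool
  residue k = does (any? λ i → g i ≟ k)

  residue⁻ : ∀ {k} → residue k ≡ true → ∃ λ i → g i ≡ k
  residue⁻ {k} = true⇒witness (any? λ i → g i ≟ k)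

  residue⁺ : ∀ i → residue (g i) ≡ true
  residue⁺ i = dec-true (any? λ j → g j ≟ g i) (i , refl)

  translate : ℕ → VSet q
  translate c z = residue ((c + toℕ z) % q)

  size-translate : ∀ {c} → c ≤ q → size (translate c) ≡ d
  size-translate {c} c≤q = trans (size-⊆⊇ ⊆image image⊆) (size-image f f-injective)
    where
    f : Fin d → Fin q
    f i = fromℕ< (shift< c (g i))
    toℕ-f : ∀ i → toℕ (f i) ≡ shift c (g i)
    toℕ-f i = toℕ-fromℕ< (shift< c (g i))
    lands : ∀ i → (c + toℕ (f i)) % q ≡ g i
    lands i = trans (cong (λ t → (c + t) % q) (toℕ-f i)) (shift-inverse c≤q (g< i))
    f-injective : Injective _≡_ _≡_ f
    f-injective {i} {j} eq = g-injective (trans (sym (lands i)) (trans (cong (λ z → (c + toℕ z) % q) eq) (lands j)))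
    ⊆image : translate c ⊆ image f
    ⊆image {z} (∈-intro h) with residue⁻ h
    ... | i , gi≡ = subst (_∈ image f) (toℕ-injective (trans (toℕ-f i) (sym z≡))) (∈-image⁺ f i)
      where z≡ = shift-unique c≤q (toℕ<n z) (sym gi≡)
    image⊆ : image f ⊆ translate c
    image⊆ h with ∈-image⁻ f h
    ... | i , refl = ∈-intro (subst (λ k → residue k ≡ true) (sym (lands i)) (residue⁺ i))

  H : Fin p → Fin q → Bool
  H x y = residue ((toℕ x + toℕ y) % q)

  left<q : (x : Fin p) → toℕ x < q
  left<q x = <-≤-trans (toℕ<n x) (m≤m+n p e)

  size-row : ∀ x → size (H x) ≡ d
  size-row x = size-translate (<⇒≤ (left<q x))

  -- Completing the column of y by its e residues outside the left part gives a full translate.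
  column-split : ∀ y → size (λ x → H x y) + size (translate (toℕ y) ∘ (p ↑ʳ_)) ≡ d
  column-split y = begin
    size (λ x → H x y) + size (translate (toℕ y) ∘ (p ↑ʳ_))
      ≡⟨ cong (_+ size (translate (toℕ y) ∘ (p ↑ʳ_))) (size-cong column≡) ⟩
    size (translate (toℕ y) ∘ (_↑ˡ e)) + size (translate (toℕ y) ∘ (p ↑ʳ_))
      ≡⟨ size-↑ p (translate (toℕ y)) ⟨
    size (translate (toℕ y))
      ≡⟨ size-translate (<⇒≤ (toℕ<n y)) ⟩
    d ∎
    where
    open ≡-Reasoning
    column≡ : ∀ x → H x y ≡ translate (toℕ y) (x ↑ˡ e)
    column≡ x = cong (λ t → residue (t % q)) (trans (+-comm (toℕ x) (toℕ y)) (cong (toℕ y +_) (sym (toℕ-↑ˡ x e))))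

  size-column≤ : ∀ y → size (λ x → H x y) ≤ d
  size-column≤ y = subst (size (λ x → H x y) ≤_) (column-split y) (m≤m+n _ _)

  size-column≥ : ∀ y → d ≤ size (λ x → H x y) + e
  size-column≥ y = subst (_≤ size (λ x → H x y) + e) (column-split y) (+-monoʳ-≤ (size (λ x → H x y)) (size≤ _))

  C₄-free : TwoCliques.C₄-Free H
  C₄-free {x} {x'} {y} {y'} h₁ h₂ h₃ h₄ with residue⁻ h₁ | residue⁻ h₂ | residue⁻ h₃ | residue⁻ h₄
  ... | i₁ , k₁ | i₂ , k₂ | i₃ , k₃ | i₄ , k₄ with g-Sidon i₁ i₄ i₂ i₃ sums
    where
    sums : (g i₁ + g i₄) % q ≡ (g i₂ + g i₃) % q
    sums = begin
      (g i₁ + g i₄) % q                                    ≡⟨ cong₂ (λ s t → (s + t) % q) k₁ k₄ ⟩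
      ((toℕ x + toℕ y) % q + (toℕ x' + toℕ y') % q) % q    ≡⟨ %-distribˡ-+ (toℕ x + toℕ y) _ q ⟨
      (toℕ x + toℕ y + (toℕ x' + toℕ y')) % q              ≡⟨ cong (_% q) (swap (toℕ x) _ _ _) ⟩
      (toℕ x + toℕ y' + (toℕ x' + toℕ y)) % q              ≡⟨ %-distribˡ-+ (toℕ x + toℕ y') _ q ⟩
      ((toℕ x + toℕ y') % q + (toℕ x' + toℕ y) % q) % q    ≡⟨ cong₂ (λ s t → (s + t) % q) k₂ k₃ ⟨
      (g i₂ + g i₃) % q                                    ∎
      where
      open ≡-Reasoning
      swap : ∀ a b c d → a + b + (c + d) ≡ a + d + (c + b)
      swap = solve-∀
  ... | inj₁ (refl , _) =
    inj₂ (toℕ-injective (translation-injective (<⇒≤ (left<q x)) (toℕ<n y) (toℕ<n y') (trans (sym k₁) k₂)))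
  ... | inj₂ (refl , _) =
    inj₁ (toℕ-injective (translation-injective (<⇒≤ (toℕ<n y)) (left<q x) (left<q x')
           (trans (flip x) (trans (trans (sym k₁) k₃) (sym (flip x'))))))
    where
    flip : ∀ (z : Fin p) → (toℕ y + toℕ z) % q ≡ (toℕ z + toℕ y) % q
    flip z = cong (_% q) (+-comm (toℕ y) (toℕ z))

-- Powers of two

2^-injective : ∀ {a b} → 2 ^ a ≡ 2 ^ b → a ≡ b
2^-injective {a} {b} eq = trans (sym (⌊log₂[2^n]⌋≡n a)) (trans (cong ⌊log₂_⌋ eq) (⌊log₂[2^n]⌋≡n b))

2*-injective : ∀ {a b} → 2 * a ≡ 2 * b → a ≡ b
2*-injective {a} {b} = *-cancelˡ-≡ a b 2

2^+2^-even : ∀ a b → 2 ^ suc a + 2 ^ suc b ≡ 2 * (2 ^ a + 2 ^ b)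
2^+2^-even a b = sym (*-distribˡ-+ 2 (2 ^ a) (2 ^ b))

2^+2^≢1 : ∀ a b → 2 ^ a + 2 ^ b ≢ 1
2^+2^≢1 a b eq = <⇒≱ (+-mono-≤ (m^n>0 2 a) (m^n>0 2 b)) (≤-reflexive eq)

2^+2^≤2^ : ∀ {a b d} → a < d → b < d → 2 ^ a + 2 ^ b ≤ 2 ^ d
2^+2^≤2^ {d = suc d} (s≤s a≤d) (s≤s b≤d) =
  ≤-trans (+-mono-≤ (^-monoʳ-≤ 2 a≤d) (^-monoʳ-≤ 2 b≤d))
          (≤-reflexive (cong (2 ^ d +_) (sym (+-identityʳ (2 ^ d)))))

2^-Sidon₀ : ∀ j k l → 2 ^ 0 + 2 ^ j ≡ 2 ^ k + 2 ^ l → SamePair 0 j k l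
2^-Sidon₀ zero    zero    zero    _  = inj₁ (refl , refl)
2^-Sidon₀ zero    zero    (suc l) eq = ⊥-elim (even≢odd 1 (2 ^ l) eq)
2^-Sidon₀ zero    (suc k) zero    eq = ⊥-elim (even≢odd 1 (2 ^ k) (trans eq (+-comm (2 ^ suc k) 1)))
2^-Sidon₀ zero    (suc k) (suc l) eq = ⊥-elim (2^+2^≢1 k l (sym (2*-injective (trans eq (2^+2^-even k l)))))
2^-Sidon₀ (suc j) zero    zero    eq = ⊥-elim (even≢odd 1 (2 ^ j) (sym eq))
2^-Sidon₀ (suc j) zero    (suc l) eq = inj₁ (refl , cong suc (2^-injective (2*-injective (suc-injective eq))))
2^-Sidon₀ (suc j) (suc k) zero    eq =
  inj₂ (refl , cong suc (2^-injective (2*-injective (suc-injective (trans eq (+-comm (2 ^ suc k) 1))))))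
2^-Sidon₀ (suc j) (suc k) (suc l) eq = ⊥-elim (even≢odd (2 ^ k + 2 ^ l) (2 ^ j) (sym (trans eq (2^+2^-even k l))))

2^-Sidon : ∀ i j k l → 2 ^ i + 2 ^ j ≡ 2 ^ k + 2 ^ l → SamePair i j k l
2^-Sidon zero    j       k       l       eq = 2^-Sidon₀ j k l eq
2^-Sidon (suc i) zero    k       l       eq with 2^-Sidon₀ (suc i) k l (trans (+-comm 1 (2 ^ suc i)) eq)
... | inj₁ (0≡k , 1+i≡l) = inj₂ (1+i≡l , 0≡k)
... | inj₂ (0≡l , 1+i≡k) = inj₁ (1+i≡k , 0≡l)
2^-Sidon (suc i) (suc j) zero    l       eq with 2^-Sidon₀ l (suc i) (suc j) (sym eq)
... | inj₁ (() , _)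
... | inj₂ (() , _)
2^-Sidon (suc i) (suc j) (suc k) zero    eq with 2^-Sidon₀ (suc k) (suc i) (suc j) (trans (+-comm 1 (2 ^ suc k)) (sym eq))
... | inj₁ (() , _)
... | inj₂ (() , _)
2^-Sidon (suc i) (suc j) (suc k) (suc l) eq
  with 2^-Sidon i j k l (2*-injective (trans (sym (2^+2^-even i j)) (trans eq (2^+2^-even k l))))
... | inj₁ (i≡k , j≡l) = inj₁ (cong suc i≡k , cong suc j≡l)
... | inj₂ (i≡l , j≡k) = inj₂ (cong suc i≡l , cong suc j≡k)

powers-of-two-injective : ∀ {d} → Injective _≡_ _≡_ (λ (i : Fin d) → 2 ^ toℕ i)
powers-of-two-injective = toℕ-injective ∘ 2^-injective

powers-of-two-Sidon : ∀ {d} q .{{_ : NonZero q}} → 2 ^ d < q → IsSidonModulo q (λ (i : Fin d) → 2 ^ toℕ i)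
powers-of-two-Sidon q 2^d<q i j k l eq
  with 2^-Sidon (toℕ i) (toℕ j) (toℕ k) (toℕ l) (trans (sym (small i j)) (trans eq (small k l)))
  where
  small : ∀ a b → (2 ^ toℕ a + 2 ^ toℕ b) % q ≡ 2 ^ toℕ a + 2 ^ toℕ b
  small a b = m<n⇒m%n≡m (≤-<-trans (2^+2^≤2^ (toℕ<n a) (toℕ<n b)) 2^d<q)
... | inj₁ (i≡k , j≡l) = inj₁ (toℕ-injective i≡k , toℕ-injective j≡l)
... | inj₂ (i≡l , j≡k) = inj₂ (toℕ-injective i≡l , toℕ-injective j≡k)

circulant-construction : ∀ k p e → 4 + k ≤ p → 2 ^ suc k < p →
                         Σ (Graph (p + (p + e))) λ G → MinDegreeIs G (p + k) × mGreaterThan G (4 + k) (4 + k)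
circulant-construction k p e 4+k≤p 2^d<p =
  T.graph , min-degree , subst (λ r → mGreaterThan T.graph r r) (+-comm d 3) m>r
  where
  d = suc k
  q = p + e
  2^d<q : 2 ^ d < q
  2^d<q = <-≤-trans 2^d<p (m≤m+n p e)
  instance
    q≢0 : NonZero q
    q≢0 = >-nonZero (<-trans (m^n>0 2 d) 2^d<q)

  g : Fin d → ℕ
  g i = 2 ^ toℕ i

  g< : ∀ i → g i < q
  g< i = <-trans (^-monoʳ-< 2 (s≤s (s≤s z≤n)) (toℕ<n i)) 2^d<q

  module C = Circulant p e g powers-of-two-injective g< (powers-of-two-Sidon q 2^d<q)
  module T = TwoCliques C.H

  m>r : mGreaterThan T.graph (d + 3) (d + 3)
  m>r = T.m>d+3 d (≤-reflexive ∘ C.size-row) C.size-column≤ C.C₄-free d+3≤p (≤-trans d+3≤p (m≤m+n p e))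
    where d+3≤p = subst (_≤ p) (sym (+-comm d 3)) 4+k≤p

  min-degree : MinDegreeIs T.graph (p + k)
  min-degree = T.min-degree (trans (+-assoc p k 1) (cong (p +_) (+-comm k 1))) C.size-row column≥
                 (fromℕ< (<-trans (m^n>0 2 d) 2^d<p))
    where
    column≥ : ∀ y → p + d ≤ q + size (T.column y)
    column≥ y = ≤-trans (+-monoʳ-≤ p (C.size-column≥ y)) (≤-reflexive (x∙yz≈xz∙y p (size (T.column y)) e))

corollary2p2 : (r : ℕ) → 4 ≤ r →
    ∃ λ (n₀ : ℕ) → (n : ℕ) → n₀ ≤ n →
    Σ (Graph n) λ G → MinDegreeIs G (n / 2 + (r ∸ 4)) × mGreaterThan G r r
corollary2p2 _ (s≤s (s≤s (s≤s (s≤s (z≤n {k}))))) = (2 ^ r + r) * 2 , graph-of-order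
  where
  r = 4 + k
  graph-of-order : ∀ n → (2 ^ r + r) * 2 ≤ n → Σ (Graph n) λ G → MinDegreeIs G (n / 2 + k) × mGreaterThan G r r
  graph-of-order n n₀≤n = subst (λ m → Σ (Graph m) λ G → MinDegreeIs G (n / 2 + k) × mGreaterThan G r r)
    (sym halves) (circulant-construction k (n / 2) (n % 2) r≤p 2^d<p)
    where
    big : 2 ^ r + r ≤ n / 2
    big = subst (_≤ n / 2) (m*n/n≡m (2 ^ r + r) 2) (/-monoˡ-≤ 2 n₀≤n)
    r≤p : r ≤ n / 2
    r≤p = ≤-trans (m≤n+m r (2 ^ r)) big
    2^d<p : 2 ^ suc k < n / 2
    2^d<p = <-≤-trans (^-monoʳ-< 2 (s≤s (s≤s z≤n)) (s≤s (m≤n+m (suc k) 2))) (≤-trans (m≤m+n (2 ^ r) r) big)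
    halves : n ≡ n / 2 + (n / 2 + n % 2)
    halves = trans (m≡m%n+[m/n]*n n 2) (rearrange (n % 2) (n / 2))
      where
      rearrange : ∀ a b → a + b * 2 ≡ b + (b + a)
      rearrange = solve-∀
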